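{- For any reals $a_1,a_2,a_3,b_1,b_2,b_3$, the matrices $\mathcal{V}(a_1,a_2,a_3,b_1,b_2,b_3)$ and $\mathcal{V}(b_3,b_2,b_1,a_3,a_2,a_1)$ coincide up to a permutation of rows and a permutation of columns.
   Context: Row and column indices of all $7$-row or $7$-column matrices are elements of $\mathbb{Z}/7\mathbb{Z}$. For $\alpha=(a_1,a_2,a_3,b_1,b_2,b_3)$ let $W(\alpha)$ be the $7$-by-$3$ matrix whose rows are, in order, $(0,1,1)$, $(0,0,1)$, $(1,0,0)$, $(1,1,0)$, $(a_1,1,b_1)$, $(a_2,1,b_2)$, $(a_3,1,b_3)$. For rows $r,s,t$, let $W[r,s,t]$ denote the $3\times3$ submatrix formed by rows $r,s,t$ in that order. Then $\mathcal{V}(\alpha)$ is the $7$-by-$7$ matrix whose $(i,j)$ entry is $\det W(\alpha)[i-1,\,j-2,\,j-1]$. -}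

module Defs where

open import Level using (Level)
open import Data.Nat using (ℕ) renaming (_+_ to _+ℕ_; _∸_ to _∸ℕ_)
open import Data.Nat.DivMod using (_mod_)
open import Data.Fin using (Fin; zero; suc; toℕ)
open import Data.Fin.Permutation using (Permutation′; _⟨$⟩ʳ_)
open import Data.Product using (∃₂; _,_)
open import Algebra.Bundles using (CommutativeRing)

-- Index arithmetic in ℤ/7ℤ, with Fin 7 = {0,…,6} as representatives:
-- minus k i = i - k (mod 7)
minus : ℕ → Fin 7 → Fin 7
minus k i = (toℕ i +ℕ (7 ∸ℕ k)) mod 7

module _ {c ℓ : Level} (R : CommutativeRing c ℓ) where
  open CommutativeRing R using (Carrier; _≈_; _+_; _*_; _-_; 0#; 1#)

  record Params : Set c where
    constructor params
    field a₁ a₂ a₃ b₁ b₂ b₃ : Carrier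

  W : Params → Fin 7 → Fin 3 → Carrier
  W p i j = row i j
    where
    open Params p
    r : Carrier → Carrier → Carrier → Fin 3 → Carrier
    r x y z zero = x
    r x y z (suc zero) = y
    r x y z (suc (suc zero)) = z
    row : Fin 7 → Fin 3 → Carrier
    row zero = r 0# 1# 1#
    row (suc zero) = r 0# 0# 1#
    row (suc (suc zero)) = r 1# 0# 0#
    row (suc (suc (suc zero))) = r 1# 1# 0#
    row (suc (suc (suc (suc zero)))) = r a₁ 1# b₁
    row (suc (suc (suc (suc (suc zero))))) = r a₂ 1# b₂
    row (suc (suc (suc (suc (suc (suc zero)))))) = r a₃ 1# b₃

  det3 : (Fin 3 → Carrier) → (Fin 3 → Carrier) → (Fin 3 → Carrier) → Carrier
  det3 u v w =
      u zero * (v (suc zero) * w (suc (suc zero)) - v (suc (suc zero)) * w (suc zero))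
    - u (suc zero) * (v zero * w (suc (suc zero)) - v (suc (suc zero)) * w zero)
    + u (suc (suc zero)) * (v zero * w (suc zero) - v (suc zero) * w zero)

  𝒱 : Params → Fin 7 → Fin 7 → Carrier
  𝒱 p i j = det3 (W p (minus 1 i)) (W p (minus 2 j)) (W p (minus 1 j))

  EqUpToRowColPerm : (Fin 7 → Fin 7 → Carrier) → (Fin 7 → Fin 7 → Carrier) → Set ℓ
  EqUpToRowColPerm M N =
    ∃₂ λ (σ τ : Permutation′ 7) → ∀ i j → M (σ ⟨$⟩ʳ i) (τ ⟨$⟩ʳ j) ≈ N i j

module Submission where

-- Over ℤ/7ℤ, W(b₃,b₂,b₁,a₃,a₂,a₁) is W(a₁,a₂,a₃,b₁,b₂,b₃) with its rows permuted by
-- k ↦ 3 − k and its columns reversed. Reversing the columns of a 3×3 matrix and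
-- swapping two of its rows each negate the determinant, so every entry of
-- 𝒱(b₃,…,a₁) is an entry of 𝒱(a₁,…,b₃), read off at row 5 − i and column 6 − j.

open import Level using (Level)
open import Function using (_∘_; id)
open import Data.Fin using (Fin; zero; suc; toℕ; opposite; _≟_)
open import Data.Fin.Properties using (all?)
open import Data.Fin.Permutation using (Permutation′; permutation)
open import Data.Product using (_,_)
open import Relation.Nullary.Decidable using (True; toWitness)
open import Relation.Binary.PropositionalEquality using (_≡_; _≗_; refl)
open import Algebra.Bundles using (CommutativeRing)
open import Defs

pattern 0F = zero
pattern 1F = suc 0F
pattern 2F = suc 1F
pattern 3F = suc 2F
pattern 4F = suc 3F
pattern 5F = suc 4F
pattern 6F = suc 5F

-- reflect c i = c − i in ℤ/7ℤ (valid since toℕ i ≤ 7)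
reflect : Fin 7 → Fin 7 → Fin 7
reflect c i = minus (toℕ i) c

≗-by-evaluation : ∀ {m n} (f g : Fin m → Fin n) → {True (all? λ i → f i ≟ g i)} → f ≗ g
≗-by-evaluation f g {t} = toWitness t

reflect-involutive : ∀ c → reflect c ∘ reflect c ≗ id
reflect-involutive c = toWitness {a? = all? λ c → all? λ i → reflect c (reflect c i) ≟ i} _ c

reflection : Fin 7 → Permutation′ 7
reflection c = permutation (reflect c) (reflect c) (reflect-involutive c) (reflect-involutive c)

minus-1-reflect-5 : minus 1 ∘ reflect 5F ≗ reflect 3F ∘ minus 1
minus-1-reflect-5 = ≗-by-evaluation _ _

minus-1-reflect-6 : minus 1 ∘ reflect 6F ≗ reflect 3F ∘ minus 2
minus-1-reflect-6 = ≗-by-evaluation _ _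

minus-2-reflect-6 : minus 2 ∘ reflect 6F ≗ reflect 3F ∘ minus 1
minus-2-reflect-6 = ≗-by-evaluation _ _

module _ {c ℓ : Level} (R : CommutativeRing c ℓ) where
  open CommutativeRing R hiding (refl)
  open import Relation.Binary.Reasoning.Setoid setoid

  det3-cong : ∀ {u v w u′ v′ w′ : Fin 3 → Carrier} →
    u ≗ u′ → v ≗ v′ → w ≗ w′ → det3 R u v w ≡ det3 R u′ v′ w′
  det3-cong u≗u′ v≗v′ w≗w′
    rewrite u≗u′ 0F | u≗u′ 1F | u≗u′ 2F
          | v≗v′ 0F | v≗v′ 1F | v≗v′ 2F
          | w≗w′ 0F | w≗w′ 1F | w≗w′ 2F = refl

  -- Two sign changes: reversing the columns, and swapping the last two rows.
  det3-opposite-columns : ∀ u v w →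
    det3 R (u ∘ opposite) (v ∘ opposite) (w ∘ opposite) ≈ det3 R u w v
  det3-opposite-columns u v w = begin
    u 2F * (v 1F * w 0F - v 0F * w 1F) - u 1F * (v 2F * w 0F - v 0F * w 2F)
      + u 0F * (v 2F * w 1F - v 1F * w 2F)
      ≈⟨ +-cong (+-cong (*-congˡ (minor-transpose v w 1F 0F))
                        (-‿cong (*-congˡ (minor-transpose v w 2F 0F))))
                (*-congˡ (minor-transpose v w 2F 1F)) ⟩
    C - B + A
      ≈⟨ +-comm (C - B) A ⟩
    A + (C - B)
      ≈⟨ +-congˡ (+-comm C (- B)) ⟩
    A + (- B + C)
      ≈⟨ +-assoc A (- B) C ⟨
    A - B + C ∎
    where
    minor-transpose : ∀ (v w : Fin 3 → Carrier) k l →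
      v k * w l - v l * w k ≈ w l * v k - w k * v l
    minor-transpose v w k l = +-cong (*-comm (v k) (w l)) (-‿cong (*-comm (v l) (w k)))
    A = u 0F * (w 1F * v 2F - w 2F * v 1F)
    B = u 1F * (w 0F * v 2F - w 2F * v 0F)
    C = u 2F * (w 0F * v 1F - w 1F * v 0F)

  mirror : Params R → Params R
  mirror p = params b₃ b₂ b₁ a₃ a₂ a₁
    where open Params p

  W-mirror : ∀ p k → W R (mirror p) k ≗ W R p (reflect 3F k) ∘ opposite
  W-mirror p 0F 0F = refl
  W-mirror p 0F 1F = refl
  W-mirror p 0F 2F = refl
  W-mirror p 1F 0F = refl
  W-mirror p 1F 1F = refl
  W-mirror p 1F 2F = refl
  W-mirror p 2F 0F = refl
  W-mirror p 2F 1F = refl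
  W-mirror p 2F 2F = refl
  W-mirror p 3F 0F = refl
  W-mirror p 3F 1F = refl
  W-mirror p 3F 2F = refl
  W-mirror p 4F 0F = refl
  W-mirror p 4F 1F = refl
  W-mirror p 4F 2F = refl
  W-mirror p 5F 0F = refl
  W-mirror p 5F 1F = refl
  W-mirror p 5F 2F = refl
  W-mirror p 6F 0F = refl
  W-mirror p 6F 1F = refl
  W-mirror p 6F 2F = refl

  𝒱-mirror : ∀ p i j → 𝒱 R p (reflect 5F i) (reflect 6F j) ≈ 𝒱 R (mirror p) i j
  𝒱-mirror p i j = begin
    det3 R (W R p (minus 1 (reflect 5F i))) (W R p (minus 2 (reflect 6F j)))
           (W R p (minus 1 (reflect 6F j)))
      ≡⟨ det3-cong (row (minus-1-reflect-5 i)) (row (minus-2-reflect-6 j))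
                   (row (minus-1-reflect-6 j)) ⟩
    det3 R (W R p (ρ (minus 1 i))) (W R p (ρ (minus 1 j))) (W R p (ρ (minus 2 j)))
      ≈⟨ det3-opposite-columns (W R p (ρ (minus 1 i))) (W R p (ρ (minus 2 j)))
                               (W R p (ρ (minus 1 j))) ⟨
    det3 R (W R p (ρ (minus 1 i)) ∘ opposite) (W R p (ρ (minus 2 j)) ∘ opposite)
           (W R p (ρ (minus 1 j)) ∘ opposite)
      ≡⟨ det3-cong (W-mirror p (minus 1 i)) (W-mirror p (minus 2 j))
                   (W-mirror p (minus 1 j)) ⟨
    𝒱 R (mirror p) i j ∎
    where
    ρ = reflect 3F
    row : ∀ {k l} → k ≡ l → W R p k ≗ W R p l
    row refl _ = refl

lemma2p3 : {c ℓ : Level} (R : CommutativeRing c ℓ) →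
    (a₁ a₂ a₃ b₁ b₂ b₃ : CommutativeRing.Carrier R) →
    EqUpToRowColPerm R (𝒱 R (params a₁ a₂ a₃ b₁ b₂ b₃)) (𝒱 R (params b₃ b₂ b₁ a₃ a₂ a₁))
lemma2p3 R a₁ a₂ a₃ b₁ b₂ b₃ =
  reflection 5F , reflection 6F , 𝒱-mirror R (params a₁ a₂ a₃ b₁ b₂ b₃)
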